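{- Let $n \geq 3$ and let $S$ be a $4$-cap free, $n$-cup free configuration with $|S| \geq \binom{n-1}{2}+1$, equipped with a slope labeling. For $p \in S$ let $\beta(p)$ be the maximum size of a cup in $S$ ending with $p$, and for $1 \le i \le n-1$ let $R_i(S) = \{p \in S : \beta(p) = i\}$. Then $R_i(S)$ is nonempty for every $1 \leq i \leq n-1$.
   Context: A configuration is a finite set $S$ with a linear order $<$, together with an arbitrary assignment, to each $3$-element subset, of "cap" or "cup". Points $x_1 < \cdots < x_m$ form an $m$-cup (resp. $m$-cap) if every consecutive triple $x_{i-1}x_ix_{i+1}$ is labeled cup (resp. cap); 1- and 2-element sets count as both; such a cup ends with $x_m$ and has size $m$. A slope labeling of a $4$-cap free configuration assigns $s(xy)\in\{1,2\}$ to each pair $x<y$ such that for all $x<y<z$, $s(xy)\le s(yz)$ implies $\{x,y,z\}$ is a cup (the statement does not depend on the choice of labeling). -}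

module Defs where

open import Data.Nat using (ℕ; _≤_)
open import Data.Fin using (Fin) renaming (_<_ to _<ᶠ_; _≤_ to _≤ᶠ_)
open import Data.List using (List; []; _∷_; length; last)
open import Data.Maybe using (just)
open import Data.Empty using (⊥)
open import Data.Product using (Σ; _×_)
open import Relation.Binary.PropositionalEquality using (_≡_)

-- A configuration on N points: the linearly ordered set is Fin N with its
-- natural order; every 3-subset {x<y<z} gets a label via lab x y z
-- (values of lab on non-increasing triples are irrelevant).
data Label : Set where
  cup cap : Label

Configuration : ℕ → Set
Configuration N = Fin N → Fin N → Fin N → Label

data Chain {N : ℕ} (lab : Configuration N) (b : Label) : List (Fin N) → Set where
  nil  : Chain lab b []
  one  : ∀ x → Chain lab b (x ∷ [])
  two  : ∀ {x y} → x <ᶠ y → Chain lab b (x ∷ y ∷ [])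
  more : ∀ {x y z zs} → x <ᶠ y → lab x y z ≡ b →
         Chain lab b (y ∷ z ∷ zs) → Chain lab b (x ∷ y ∷ z ∷ zs)

IsCup IsCap : {N : ℕ} → Configuration N → List (Fin N) → Set
IsCup lab xs = Chain lab cup xs
IsCap lab xs = Chain lab cap xs

CupFree CapFree : {N : ℕ} → Configuration N → ℕ → Set
CupFree lab m = ∀ xs → IsCup lab xs → length xs ≡ m → ⊥
CapFree lab m = ∀ xs → IsCap lab xs → length xs ≡ m → ⊥

-- Slope labeling s : pairs x<y ↦ {1,2} (encoded as Fin 2, 0 ↦ 1, 1 ↦ 2):
-- for all x<y<z, s(xy) ≤ s(yz) implies {x,y,z} is a cup.
IsSlopeLabeling : {N : ℕ} → Configuration N → (Fin N → Fin N → Fin 2) → Set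
IsSlopeLabeling {N} lab s =
  ∀ (x y z : Fin N) → x <ᶠ y → y <ᶠ z → s x y ≤ᶠ s y z → lab x y z ≡ cup

CupEndingAt : {N : ℕ} → Configuration N → Fin N → List (Fin N) → Set
CupEndingAt lab p xs = IsCup lab xs × last xs ≡ just p

β≡ : {N : ℕ} → Configuration N → Fin N → ℕ → Set
β≡ lab p i =
  Σ (List _) (λ xs → CupEndingAt lab p xs × length xs ≡ i)
  × (∀ xs → CupEndingAt lab p xs → length xs ≤ i)

{-# OPTIONS --safe #-}
module Submission where

-- Write m = n − 1. If some point ends a cup of size m, then for every i ≤ m
-- some point ends a cup of size i, and deleting the last point of a cup of
-- size i + 1 leaves a cup of size i ending further left; walking left we thus
-- reach a point with β = i. Otherwise β only takes the values 1, …, m − 1.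
-- Two points x < y with the same β have s(xy) = 1: were s(xy) = 2, the slope
-- condition would make every w < x form a cup with x and y, so y would extend
-- every cup ending at x. Hence each class R_j is itself a cup ending in R_j,
-- so |R_j| ≤ j and |S| ≤ 1 + ⋯ + (m − 1) = C(m, 2), against the hypothesis.

open import Defs
open import Data.Nat using (ℕ; _≤_; _∸_; _+_; suc)
open import Data.Nat.Combinatorics using (_C_)
open import Data.Fin using (Fin)
open import Data.Product using (∃; Σ)

open import Data.Nat using (zero; z≤n; s≤s)
open import Data.Nat.Properties
  using (suc-injective; +-suc; +-comm; +-mono-≤; ≤-refl; ≤-pred; ≤∧≢⇒<; <⇒≱; ≮⇒≥; m∸n+n≡m;
         m≤n⇒m≤1+n; module ≤-Reasoning)
open import Data.Nat.Combinatorics using (nC1≡n; nCk+nC[k+1]≡[n+1]C[k+1])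
open import Data.Fin using () renaming (zero to fzero; suc to fsuc; _<_ to _<ᶠ_; _≤_ to _≤ᶠ_)
open import Data.Fin.Properties using (_<?_; any?; ≤fromℕ) renaming (_≟_ to _≟ᶠ_)
open import Data.Fin.Induction using (<-wellFounded)
open import Induction.WellFounded using (Acc; acc)
open import Data.List using (List; []; _∷_; _∷ʳ_; length; last; filter)
open import Data.List.Properties using (length-++; length-tabulate)
open import Data.List.Relation.Unary.All as All using (All; []; _∷_)
open import Data.List.Relation.Unary.All.Properties using (last⁺; all-filter; filter⁺; tabulate⁺)
open import Data.List.Relation.Unary.AllPairs using (AllPairs; _∷_)
import Data.List.Relation.Unary.AllPairs.Properties as AllPairs
open import Data.Maybe using (just)
import Data.Maybe.Relation.Unary.All as Maybe
open import Data.Maybe.Properties using (just-injective; ≡-dec)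
open import Data.Product using (_×_; _,_; proj₂; ∃-syntax)
open import Function using (id; _∘_)
open import Relation.Nullary using (¬_; Dec; yes; no; contradiction)
open import Relation.Nullary.Decidable using (_×-dec_; ¬?; map′)
open import Relation.Unary using (Decidable)
open import Relation.Unary.Properties using (∁?)
open import Relation.Binary.Definitions using (DecidableEquality)
open import Relation.Binary.PropositionalEquality using (_≡_; refl; sym; trans; cong; subst)

_≟ᴸ_ : DecidableEquality Label
cup ≟ᴸ cup = yes refl
cup ≟ᴸ cap = no λ ()
cap ≟ᴸ cup = no λ ()
cap ≟ᴸ cap = yes refl

init : {A : Set} → List A → List A
init []               = []
init (x ∷ [])         = []
init (x ∷ xs@(_ ∷ _)) = x ∷ init xs

length-init : {A : Set} (x : A) (xs : List A) → length (init (x ∷ xs)) ≡ length xs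
length-init x []       = refl
length-init x (y ∷ ys) = cong suc (length-init y ys)

last-∷ʳ : {A : Set} (xs : List A) (y : A) → last (xs ∷ʳ y) ≡ just y
last-∷ʳ []            y = refl
last-∷ʳ (x ∷ [])      y = refl
last-∷ʳ (x ∷ x′ ∷ xs) y = last-∷ʳ (x′ ∷ xs) y

last-∷ : {A : Set} (x : A) (xs : List A) → ∃[ p ] last (x ∷ xs) ≡ just p
last-∷ x []       = x , refl
last-∷ x (y ∷ ys) = last-∷ y ys

length-filter+length-filter-∁ : {A : Set} {P : A → Set} (P? : Decidable P) (xs : List A) →
  length (filter P? xs) + length (filter (∁? P?) xs) ≡ length xs
length-filter+length-filter-∁ P? []       = refl
length-filter+length-filter-∁ P? (x ∷ xs) with P? x
... | yes _ = cong suc (length-filter+length-filter-∁ P? xs)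
... | no  _ = trans (+-suc _ _) (cong suc (length-filter+length-filter-∁ P? xs))

∃-ofLength? : ∀ {N} {P : List (Fin N) → Set} → Decidable P →
  ∀ k → Dec (∃ λ xs → P xs × length xs ≡ k)
∃-ofLength? P? zero = map′ (λ p → [] , p , refl) (λ { ([] , p , _) → p }) (P? [])
∃-ofLength? P? (suc k) =
  map′ (λ (x , xs , p , e) → x ∷ xs , p , cong suc e)
       (λ { (x ∷ xs , p , e) → x , xs , p , suc-injective e })
       (any? λ x → ∃-ofLength? (P? ∘ (x ∷_)) k)

module _ {N : ℕ} (lab : Configuration N) where

  chain? : ∀ b → Decidable (Chain lab b)
  chain? b []           = yes nil
  chain? b (x ∷ [])     = yes (one x)
  chain? b (x ∷ y ∷ []) = map′ two (λ { (two x<y) → x<y }) (x <? y)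
  chain? b (x ∷ y ∷ z ∷ zs) =
    map′ (λ (x<y , e , c) → more x<y e c) (λ { (more x<y e c) → x<y , e , c })
         (x <? y ×-dec lab x y z ≟ᴸ b ×-dec chain? b (y ∷ z ∷ zs))

  Chain-tail : ∀ {b x xs} → Chain lab b (x ∷ xs) → Chain lab b xs
  Chain-tail (one _)         = nil
  Chain-tail (two {y = y} _) = one y
  Chain-tail (more _ _ c)    = c

  Chain-init : ∀ {b xs} → Chain lab b xs → Chain lab b (init xs)
  Chain-init nil                         = nil
  Chain-init (one _)                     = nil
  Chain-init (two {x} _)                 = one x
  Chain-init (more {zs = []} x<y _ _)    = two x<y
  Chain-init (more {zs = _ ∷ _} x<y e c) = more x<y e (Chain-init c)

  Chain-last-init< : ∀ {b x y zs p} → Chain lab b (x ∷ y ∷ zs) → last (x ∷ y ∷ zs) ≡ just p →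
    ∃[ q ] (last (init (x ∷ y ∷ zs)) ≡ just q × q <ᶠ p)
  Chain-last-init< (two {x} x<y)             end = x , refl , subst (x <ᶠ_) (just-injective end) x<y
  Chain-last-init< (more {zs = []} _ _ c)    end = Chain-last-init< c end
  Chain-last-init< (more {zs = _ ∷ _} _ _ c) end = Chain-last-init< c end

  Chain-∷ʳ : ∀ {b x y xs} → Chain lab b xs → last xs ≡ just x → x <ᶠ y →
    (∀ {w} → w <ᶠ x → lab w x y ≡ b) → Chain lab b (xs ∷ʳ y)
  Chain-∷ʳ (one _)        refl x<y _ = two x<y
  Chain-∷ʳ (two w<x)      end  x<y extends with refl ← just-injective end =
    more w<x (extends w<x) (two x<y)
  Chain-∷ʳ (more u<v e c) end  x<y extends = more u<v e (Chain-∷ʳ c end x<y extends)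

  HasCupOfSize : ℕ → Fin N → Set
  HasCupOfSize k p = ∃ λ xs → CupEndingAt lab p xs × length xs ≡ k

  hasCupOfSize? : ∀ k p → Dec (HasCupOfSize k p)
  hasCupOfSize? k p = ∃-ofLength? (λ xs → chain? cup xs ×-dec ≡-dec _≟ᶠ_ (last xs) (just p)) k

  HasCupOfSize-zero : ∀ {p} → ¬ HasCupOfSize 0 p
  HasCupOfSize-zero ([] , (_ , ()) , _)

  HasCupOfSize-one : ∀ p → HasCupOfSize 1 p
  HasCupOfSize-one p = p ∷ [] , (one p , refl) , refl

  cup-suffix : ∀ {p j} xs → CupEndingAt lab p xs → suc j ≤ length xs → HasCupOfSize (suc j) p
  cup-suffix {p} {j} xs cupₓₛ j<len = drop-to (length xs ∸ suc j) xs cupₓₛ (sym (m∸n+n≡m j<len))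
    where
    drop-to : ∀ d xs → CupEndingAt lab p xs → length xs ≡ d + suc j → HasCupOfSize (suc j) p
    drop-to zero    xs           cupₓₛ     len = xs , cupₓₛ , len
    drop-to (suc d) (x ∷ y ∷ ys) (c , end) len = drop-to d (y ∷ ys) (Chain-tail c , end) (suc-injective len)
    drop-to (suc d) (x ∷ [])     _         len = contradiction (trans (suc-injective len) (+-suc d j)) λ ()

  cup-init : ∀ {i p} → HasCupOfSize (suc (suc i)) p → ∃[ q ] (q <ᶠ p × HasCupOfSize (suc i) q)
  cup-init (x ∷ y ∷ zs , (c , end) , len) with q , end′ , q<p ← Chain-last-init< c end =
    q , q<p , init (x ∷ y ∷ zs) , (Chain-init c , end′) ,
    trans (length-init x (y ∷ zs)) (suc-injective len)

  HasMaxCupSize : ℕ → Fin N → Set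
  HasMaxCupSize j p = HasCupOfSize j p × ¬ HasCupOfSize (suc j) p

  hasMaxCupSize? : ∀ j → Decidable (HasMaxCupSize j)
  hasMaxCupSize? j p = hasCupOfSize? j p ×-dec ¬? (hasCupOfSize? (suc j) p)

  HasMaxCupSize⇒β≡ : ∀ {j p} → HasMaxCupSize j p → β≡ lab p j
  HasMaxCupSize⇒β≡ (cupⱼ , noLonger) = cupⱼ , λ xs cupₓₛ → ≮⇒≥ (noLonger ∘ cup-suffix xs cupₓₛ)

  HasCupOfSize⇒∃β≡ : ∀ {i} p → HasCupOfSize (suc i) p → ∃[ q ] β≡ lab q (suc i)
  HasCupOfSize⇒∃β≡ p = descend p (<-wellFounded p)
    where
    descend : ∀ {i} p → Acc _<ᶠ_ p → HasCupOfSize (suc i) p → ∃[ q ] β≡ lab q (suc i)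
    descend {i} p (acc below) cupᵢ with hasCupOfSize? (suc (suc i)) p
    ... | no noLonger = p , HasMaxCupSize⇒β≡ (cupᵢ , noLonger)
    ... | yes longer with q , q<p , cup′ ← cup-init longer = descend q (below q<p) cup′

  ∃HasMaxCupSize≤ : ∀ m {p} → ¬ HasCupOfSize (suc m) p → ∃[ j ] (j ≤ m × HasMaxCupSize j p)
  ∃HasMaxCupSize≤ zero    {p} noCup = contradiction (HasCupOfSize-one p) noCup
  ∃HasMaxCupSize≤ (suc m) {p} noCup with hasCupOfSize? (suc m) p
  ... | yes cupₘ = suc m , ≤-refl , cupₘ , noCup
  ... | no  noCupₘ with j , j≤m , maxⱼ ← ∃HasMaxCupSize≤ m noCupₘ = j , m≤n⇒m≤1+n j≤m , maxⱼ

  module _ (s : Fin N → Fin N → Fin 2) (slope : IsSlopeLabeling lab s) where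

    sameMaxCupSize⇒s≡zero : ∀ {j x y} → x <ᶠ y → HasMaxCupSize j x → HasMaxCupSize j y → s x y ≡ fzero
    sameMaxCupSize⇒s≡zero {x = x} {y} x<y ((xs , (c , end) , len) , _) (_ , noLonger) with s x y in sxy
    ... | fzero      = refl
    ... | fsuc fzero = contradiction
      (xs ∷ʳ y , (Chain-∷ʳ c end x<y extends , last-∷ʳ xs y) ,
       trans (length-++ xs) (trans (+-comm _ 1) (cong suc len)))
      noLonger
      where
      extends : ∀ {w} → w <ᶠ x → lab w x y ≡ cup
      extends {w} w<x = slope w x y w<x x<y (subst (s w x ≤ᶠ_) (sym sxy) (≤fromℕ (s w x)))

    sameMaxCupSize⇒isCup : ∀ {j xs} → AllPairs _<ᶠ_ xs → All (HasMaxCupSize j) xs → IsCup lab xs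
    sameMaxCupSize⇒isCup {xs = []}         _ _ = nil
    sameMaxCupSize⇒isCup {xs = x ∷ []}     _ _ = one x
    sameMaxCupSize⇒isCup {xs = _ ∷ _ ∷ []} ((x<y ∷ _) ∷ _) _ = two x<y
    sameMaxCupSize⇒isCup {xs = x ∷ y ∷ z ∷ _}
      ((x<y ∷ _) ∷ sorted@((y<z ∷ _) ∷ _)) (maxₓ ∷ max@(maxᵧ ∷ _)) =
      more x<y (slope x y z x<y y<z (subst (_≤ᶠ s y z) (sym (sameMaxCupSize⇒s≡zero x<y maxₓ maxᵧ)) z≤n))
        (sameMaxCupSize⇒isCup sorted max)

    sameMaxCupSize⇒length≤ : ∀ {j xs} → AllPairs _<ᶠ_ xs → All (HasMaxCupSize j) xs → length xs ≤ j
    sameMaxCupSize⇒length≤ {xs = []}     _ _ = z≤n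
    sameMaxCupSize⇒length≤ {j} {x ∷ xs} sorted max
      with p , end ← last-∷ x xs
      with Maybe.just maxₚ ← subst (Maybe.All (HasMaxCupSize j)) end (last⁺ max) =
      proj₂ (HasMaxCupSize⇒β≡ maxₚ) (x ∷ xs) (sameMaxCupSize⇒isCup sorted max , end)

    length≤[1+m]C2 : ∀ m {xs} → AllPairs _<ᶠ_ xs →
      All (λ p → ∃[ j ] (j ≤ m × HasMaxCupSize j p)) xs → length xs ≤ suc m C 2
    length≤[1+m]C2 zero    {[]} _ _ = z≤n
    length≤[1+m]C2 zero    {_ ∷ _} _ ((_ , z≤n , cup₀ , _) ∷ _) = contradiction cup₀ HasCupOfSize-zero
    length≤[1+m]C2 (suc m) {xs} sorted bounded = begin
      length xs
        ≡⟨ sym (length-filter+length-filter-∁ top? xs) ⟩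
      length (filter top? xs) + length (filter (∁? top?) xs)
        ≤⟨ +-mono-≤ (sameMaxCupSize⇒length≤ (AllPairs.filter⁺ top? sorted) (all-filter top? xs))
                    (length≤[1+m]C2 m (AllPairs.filter⁺ (∁? top?) sorted)
                       (All.zipWith lower (filter⁺ (∁? top?) bounded , all-filter (∁? top?) xs))) ⟩
      suc m + suc m C 2
        ≡⟨ cong (_+ suc m C 2) (sym (nC1≡n (suc m))) ⟩
      suc m C 1 + suc m C 2
        ≡⟨ nCk+nC[k+1]≡[n+1]C[k+1] (suc m) 1 ⟩
      suc (suc m) C 2 ∎
      where
      open ≤-Reasoning
      top? = hasMaxCupSize? (suc m)
      lower : ∀ {p} → (∃[ j ] (j ≤ suc m × HasMaxCupSize j p)) × ¬ HasMaxCupSize (suc m) p →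
              ∃[ j ] (j ≤ m × HasMaxCupSize j p)
      lower ((j , j≤1+m , maxⱼ) , notTop) = j , ≤-pred (≤∧≢⇒< j≤1+m λ { refl → notTop maxⱼ }) , maxⱼ

lemma5p9 : (n N : ℕ) → 3 ≤ n → (lab : Configuration N) →
    CapFree lab 4 → CupFree lab n → suc ((n ∸ 1) C 2) ≤ N →
    (s : Fin N → Fin N → Fin 2) → IsSlopeLabeling lab s →
    ∀ i → 1 ≤ i → i ≤ n ∸ 1 → ∃ λ (p : Fin N) → β≡ lab p i
lemma5p9 (suc (suc zero)) _ (s≤s (s≤s ())) _ _ _ _ _ _ _ _ _
lemma5p9 (suc (suc (suc m))) N _ lab _ _ N>C s slope (suc i) _ i≤m+2
  with any? (hasCupOfSize? lab (suc (suc m)))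
... | yes (p , xs , cupₓₛ , len) =
  HasCupOfSize⇒∃β≡ lab p (cup-suffix lab xs cupₓₛ (subst (suc i ≤_) (sym len) i≤m+2))
... | no noLongCup = contradiction N≤C (<⇒≱ N>C)
  where
  N≤C : N ≤ suc (suc m) C 2
  N≤C = subst (_≤ _) (length-tabulate id)
    (length≤[1+m]C2 lab s slope (suc m) (AllPairs.tabulate⁺-< id)
      (tabulate⁺ λ p → ∃HasMaxCupSize≤ lab (suc m) λ cup → noLongCup (p , cup)))
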